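{- In the setting described in the context, let $N$ be even and suppose the coefficient $B$ satisfies $B^2\equiv D+4N\pmod{16N}$. Then $4\mid\theta$ if one of the following conditions is met: (a) $D\equiv1\pmod8$; (b) $16\mid D$; (c) $2\,\|\,N$ and $4\,\|\,D$.
   Context: Setting: Let $N>1$ be an integer, $N=2^{\lambda(N)}N_1$ with $N_1$ odd. Let $D=c^2\Delta<0$ be a discriminant with fundamental part $\Delta$ and conductor $c$, $K=\mathbb Q(\sqrt D)$, $\mathcal O$ the order of discriminant $D$. Let $[A,B,C]$ be a primitive positive definite integral quadratic form with $B^2-4AC=D$, $\gcd(A,N)=1$ and $N\mid C$. Let $\alpha=\frac{ -B+\sqrt D}{2A}$, so $\mathcal O=\mathbb Z+\mathbb Z A\alpha$. Let $u,v\in\mathbb Z$ be such that $\pi=u+vA\alpha$ has norm $p=u^2-uvB+v^2AC$ a prime number not dividing $6cN$ that splits in $\mathcal O$, and assume $p\mid C$ and $p\mid u$. Set $u'=u-vB$. Let $v_1$, $A_1$ be the odd parts of $v$, $A$ ($v_1=1$ if $v=0$). Define the integer $\theta=(N-1)v\left(u'\frac{C}{Np}+A\left(\frac up(1-u'^2)-u'\right)\right)+3v_1A_1(N_1-1)(u'-1)+\frac{3\lambda(N)(u'^2-1)}{2}.$ The notation $2^k\,\|\,n$ means $2^k\mid n$ and $2^{k+1}\nmid n$. -}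

module Defs where

open import Data.Nat as ℕ using (ℕ; zero; suc)
open import Data.Integer using (ℤ; +_; _+_; _-_; _*_; -_; ∣_∣; _/ℕ_; _^_)
open import Data.Integer.Divisibility using (_∣_)
open import Data.Product using (Σ; _×_)
open import Data.Sum using (_⊎_)
open import Relation.Nullary using (¬_)
open import Relation.Binary.PropositionalEquality using (_≡_)

OddZ : ℤ → Set
OddZ w = ¬ (+ 2 ∣ w)

infix 4 _‖_
_‖_ : ℕ → ℤ → Set
d ‖ n = (+ d ∣ n) × ¬ (+ (d ℕ.* 2) ∣ n)

SquarefreeZ : ℤ → Set
SquarefreeZ m = ∀ (d : ℕ) → + (d ℕ.* d) ∣ m → d ≡ 1

FundamentalDisc : ℤ → Set
FundamentalDisc Δ =
  ((+ 4 ∣ (Δ - + 1)) × SquarefreeZ Δ × ¬ (Δ ≡ + 1))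
  ⊎ Σ ℤ (λ m → (Δ ≡ + 4 * m) × ((+ 4 ∣ (m - + 2)) ⊎ (+ 4 ∣ (m - + 3))) × SquarefreeZ m)

OddPart : ℤ → ℤ → Set
OddPart v w = ((v ≡ + 0) × (w ≡ + 1)) ⊎ Σ ℕ (λ k → (v ≡ (+ 2) ^ k * w) × OddZ w)

-- an odd prime p not dividing the conductor splits in the order of discriminant D
-- iff the Legendre symbol (D/p) = 1
SplitsIn : ℕ → ℤ → Set
SplitsIn p D = ¬ (+ p ∣ D) × Σ ℤ (λ x → + p ∣ (x * x - D))

-- exact division by a natural number (only applied where the division is exact;
-- the value for divisor 0 is irrelevant)
_//_ : ℤ → ℕ → ℤ
a // zero = + 0
a // suc n = a /ℕ suc n

infixl 7 _//_

theta : (N N₁ lam p : ℕ) (A B C u v v₁ A₁ : ℤ) → ℤ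
theta N N₁ lam p A B C u v v₁ A₁ =
  let u' = u - v * B in
  (+ N - + 1) * v * (u' * (C // (N ℕ.* p)) + A * ((u // p) * (+ 1 - u' * u') - u'))
  + + 3 * v₁ * A₁ * (+ N₁ - + 1) * (u' - + 1)
  + (+ 3 * + lam * (u' * u' - + 1)) // 2

-- Write u = w p and C = m p N.  Dividing the norm equation p = u² − uvB + v²AC by p gives
-- 1 = w u' + v²AmN, so w and u' are odd because N is even; then u'² ≡ 1 (mod 8) and every
-- term of θ vanishes modulo 4 except (N − 1) v u' (m − A).  Since D = B² − 4AC, the
-- hypothesis B² ≡ D + 4N (mod 16N) says AC ≡ N (mod 4N), i.e. Amp ≡ 1 (mod 4); an odd number
-- is its own inverse modulo 4, so m ≡ Ap and v (m − A) ≡ v A (p − 1) (mod 4).  This is 0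
-- when v is even.  When v is odd, 4p = (u + u')² − v²D rules out D ≡ 1 (mod 8), and in the
-- two remaining cases D = 4d with d ≡ 0 or 3 (mod 4), so p = t² − v²d ≡ 1 (mod 4).
module Submission where

open import Data.Nat as ℕ using (ℕ; suc)
import Data.Nat.Properties as ℕ
import Data.Nat.Divisibility as ℕ
import Data.Nat.DivMod as ℕ
open import Data.Nat.Primality using (Prime; prime⇒irreducible; euclidsLemma; prime⇒nonZero)
open import Data.Integer
  using (ℤ; NonZero; +_; -[1+_]; ∣_∣; _+_; _-_; _*_; -_; _/ℕ_; _%ℕ_; _<_; _>_)
open import Data.Integer.Properties
  using (+-identityˡ; +-comm; *-comm; *-assoc; *-identityʳ; *-cancelˡ-≡; pos-*; abs-*)
open import Data.Integer.DivMod using (a≡a%ℕn+[a/ℕn]*n; n%ℕd<d)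
open import Data.Integer.Divisibility using (_∣_)
open import Data.Integer.Divisibility.Signed
  using (quotient; ∣ᵤ⇒∣; ∣⇒∣ᵤ; ∣-refl; ∣-reflexive; ∣-trans; ∣m∣n⇒∣m+n; ∣m∣n⇒∣m-n; ∣m+n∣m⇒∣n;
         ∣n⇒∣m*n; ∣m⇒∣m*n; *-cancelˡ-∣)
  renaming (_∣_ to _∣ₛ_; divides to dividesₛ)
open _∣ₛ_ using (equality)
open import Data.Integer.GCD using (gcd)
open import Data.Integer.Tactic.RingSolver using (solve)
open import Data.List using (_∷_; [])
open import Data.Product using (Σ; _,_; _×_; proj₁; proj₂)
open import Data.Sum using (_⊎_; inj₁; inj₂)
open import Data.Empty using (⊥-elim)
open import Function using (_∘_; _∋_)
open import Relation.Nullary using (¬_)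
open import Relation.Binary.PropositionalEquality
  using (_≡_; refl; sym; trans; cong; cong₂; subst; module ≡-Reasoning)

open import Defs

-- The equation comes second so that the ring solver sees both of its sides.
∣-≡ : ∀ {k x y} → k ∣ₛ x → x ≡ y → k ∣ₛ y
∣-≡ k∣x refl = k∣x

-- Case splits on parity go through a helper rather than `with`: `with` normalises the goal,
-- and a normalised `_*_` is no longer readable by the ring solver.
data Parity : ℤ → Set where
  even : ∀ k → Parity (+ 2 * k)
  odd  : ∀ k → Parity (+ 2 * k + + 1)

parity : ∀ x → Parity x
parity x with x /ℕ 2 | x %ℕ 2 | n%ℕd<d x 2 | a≡a%ℕn+[a/ℕn]*n x 2
... | q | 0 | _ | refl =
  subst Parity (trans (*-comm (+ 2) q) (sym (+-identityˡ (q * + 2)))) (even q)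
... | q | 1 | _ | refl =
  subst Parity (trans (+-comm (+ 2 * q) (+ 1)) (cong (_+_ (+ 1)) (*-comm (+ 2) q))) (odd q)
... | _ | suc (suc _) | ℕ.s≤s (ℕ.s≤s ()) | _

Odd : ℤ → Set
Odd x = ¬ (+ 2 ∣ₛ x)

2∣2* : ∀ k → + 2 ∣ₛ + 2 * k
2∣2* k = dividesₛ k (*-comm (+ 2) k)

2∤1 : ¬ (+ 2 ∣ₛ + 1)
2∤1 2∣1 with ℕ.∣1⇒≡1 (∣⇒∣ᵤ 2∣1)
... | ()

odd-2*+1 : ∀ k → Odd (+ 2 * k + + 1)
odd-2*+1 k 2∣2k+1 = 2∤1 (∣m+n∣m⇒∣n 2∣2k+1 (2∣2* k))

odd+odd : ∀ {x y} → Odd x → Odd y → + 2 ∣ₛ x + y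
odd+odd {x} {y} = go (parity x) (parity y)
  where
  go : ∀ {x y} → Parity x → Parity y → Odd x → Odd y → + 2 ∣ₛ x + y
  go (even k) _ x-odd _ = ⊥-elim (x-odd (2∣2* k))
  go _ (even l) _ y-odd = ⊥-elim (y-odd (2∣2* l))
  go (odd k) (odd l) _ _ = ∣-≡ (2∣2* (k + l + + 1)) (solve (k ∷ l ∷ []))

odd⇒2∣x-1 : ∀ {x} → Odd x → + 2 ∣ₛ x - + 1
odd⇒2∣x-1 {x} = go (parity x)
  where
  go : ∀ {x} → Parity x → Odd x → + 2 ∣ₛ x - + 1
  go (even k) x-odd = ⊥-elim (x-odd (2∣2* k))
  go (odd k) _ = ∣-≡ (2∣2* k) (solve (k ∷ []))

2∣x-1⇒odd : ∀ {x} → + 2 ∣ₛ x - + 1 → Odd x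
2∣x-1⇒odd {x} 2∣x-1 2∣x = 2∤1 (∣-≡ (∣m∣n⇒∣m-n 2∣x 2∣x-1) (solve (x ∷ [])))

odd*odd : ∀ {x y} → Odd x → Odd y → Odd (x * y)
odd*odd {x} {y} = go (parity x) (parity y)
  where
  go : ∀ {x y} → Parity x → Parity y → Odd x → Odd y → Odd (x * y)
  go (even k) _ x-odd _ = ⊥-elim (x-odd (2∣2* k))
  go _ (even l) _ y-odd = ⊥-elim (y-odd (2∣2* l))
  go (odd k) (odd l) _ _ 2∣xy = odd-2*+1 (+ 2 * k * l + k + l) (∣-≡ 2∣xy (solve (k ∷ l ∷ [])))

*-pres-∣ : ∀ {a b x y} → a ∣ₛ x → b ∣ₛ y → a * b ∣ₛ x * y
*-pres-∣ {a} {b} (dividesₛ q refl) (dividesₛ r refl) = dividesₛ (q * r) (solve (a ∷ b ∷ q ∷ r ∷ []))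

2∣k[k+1] : ∀ k → + 2 ∣ₛ k * (k + + 1)
2∣k[k+1] k = go (parity k)
  where
  go : ∀ {k} → Parity k → + 2 ∣ₛ k * (k + + 1)
  go (even l) = ∣m⇒∣m*n (+ 2 * l + + 1) (2∣2* l)
  go (odd l) = ∣-≡ (∣n⇒∣m*n (+ 2 * l + + 1) (2∣2* (l + + 1))) (solve (l ∷ []))

8∣odd²-1 : ∀ {x} → Odd x → + 8 ∣ₛ x * x - + 1
8∣odd²-1 {x} = go (parity x)
  where
  go : ∀ {x} → Parity x → Odd x → + 8 ∣ₛ x * x - + 1
  go (even k) x-odd = ⊥-elim (x-odd (2∣2* k))
  go (odd k) _ = ∣-≡ (*-pres-∣ (∣-refl {+ 4}) (2∣k[k+1] k)) (solve (k ∷ []))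

4∣8 : + 4 ∣ₛ + 8
4∣8 = dividesₛ (+ 2) refl

2∣4 : + 2 ∣ₛ + 4
2∣4 = dividesₛ (+ 2) refl

square-mod-4 : ∀ t → + 4 ∣ₛ t * t ⊎ + 8 ∣ₛ t * t - + 1
square-mod-4 t = go (parity t)
  where
  go : ∀ {t} → Parity t → + 4 ∣ₛ t * t ⊎ + 8 ∣ₛ t * t - + 1
  go (even k) = inj₁ (*-pres-∣ (2∣2* k) (2∣2* k))
  go (odd k) = inj₂ (8∣odd²-1 (odd-2*+1 k))

2∣square⇒2∣ : ∀ {x} → + 2 ∣ₛ x * x → + 2 ∣ₛ x
2∣square⇒2∣ {x} = go (parity x)
  where
  go : ∀ {x} → Parity x → + 2 ∣ₛ x * x → + 2 ∣ₛ x
  go (even k) _ = 2∣2* k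
  go (odd k) 2∣x² = ⊥-elim (odd*odd (odd-2*+1 k) (odd-2*+1 k) 2∣x²)

2∣x²-e⇒2∣x : ∀ {x e} → + 2 ∣ₛ x * x - e → + 2 ∣ₛ e → + 2 ∣ₛ x
2∣x²-e⇒2∣x {x} {e} 2∣x²-e 2∣e = 2∣square⇒2∣ (∣-≡ (∣m∣n⇒∣m+n 2∣x²-e 2∣e) (solve (x ∷ e ∷ [])))

-- m − a = a (a m − 1) − m (a² − 1).
am≡1⇒m≡a-mod-4 : ∀ {a m} → Odd a → + 4 ∣ₛ a * m - + 1 → + 4 ∣ₛ m - a
am≡1⇒m≡a-mod-4 {a} {m} a-odd 4∣am-1 =
  ∣-≡ (∣m∣n⇒∣m-n (∣n⇒∣m*n a 4∣am-1) (∣n⇒∣m*n m (∣-trans 4∣8 (8∣odd²-1 a-odd))))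
      (solve (a ∷ m ∷ []))

-- v (m − a) = v (m − a p) + a v (p − 1), and v (p − 1) is a product of two even numbers
-- unless v is odd.
4∣v[m-a] : ∀ v m a p → + 4 ∣ₛ m - a * p → Odd p → (Odd v → + 4 ∣ₛ p - + 1) → + 4 ∣ₛ v * (m - a)
4∣v[m-a] v m a p 4∣m-ap p-odd p≡1 =
  ∣-≡ (∣m∣n⇒∣m+n (∣n⇒∣m*n v 4∣m-ap) (∣n⇒∣m*n a (4∣v[p-1] (parity v) p≡1)))
      (solve (v ∷ m ∷ a ∷ p ∷ []))
  where
  4∣v[p-1] : ∀ {v} → Parity v → (Odd v → + 4 ∣ₛ p - + 1) → + 4 ∣ₛ v * (p - + 1)
  4∣v[p-1] (even k) _ = *-pres-∣ (2∣2* k) (odd⇒2∣x-1 p-odd)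
  4∣v[p-1] (odd k) p≡1 = ∣n⇒∣m*n (+ 2 * k + + 1) (p≡1 (odd-2*+1 k))

-- p ≡ t² − d (mod 4) since v² ≡ 1 (mod 8); as t² ≡ 0 or 1 and d ≡ 0 or 3 (mod 4),
-- either p ≡ 1 (mod 4) or p is even.
t²-v²d≡1-mod-4 : ∀ {p t v d} → Odd v → Odd p → p ≡ t * t - v * v * d →
               + 4 ∣ₛ d ⊎ + 4 ∣ₛ d + + 1 → + 4 ∣ₛ p - + 1
t²-v²d≡1-mod-4 {p} {t} {v} {d} v-odd p-odd refl = go (square-mod-4 t)
  where
  4∣v²-1 : + 4 ∣ₛ v * v - + 1
  4∣v²-1 = ∣-trans 4∣8 (8∣odd²-1 v-odd)
  go : + 4 ∣ₛ t * t ⊎ + 8 ∣ₛ t * t - + 1 → + 4 ∣ₛ d ⊎ + 4 ∣ₛ d + + 1 → + 4 ∣ₛ p - + 1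
  go (inj₁ 4∣t²) (inj₁ 4∣d) =
    ⊥-elim (p-odd (∣-trans 2∣4 (∣m∣n⇒∣m-n 4∣t² (∣n⇒∣m*n (v * v) 4∣d))))
  go (inj₁ 4∣t²) (inj₂ 4∣d+1) =
    ∣-≡ (∣m∣n⇒∣m-n (∣m∣n⇒∣m-n 4∣t² (∣m⇒∣m*n d 4∣v²-1)) 4∣d+1) (solve (t ∷ v ∷ d ∷ []))
  go (inj₂ 8∣t²-1) (inj₁ 4∣d) =
    ∣-≡ (∣m∣n⇒∣m-n (∣-trans 4∣8 8∣t²-1) (∣n⇒∣m*n (v * v) 4∣d)) (solve (t ∷ v ∷ d ∷ []))
  go (inj₂ 8∣t²-1) (inj₂ 4∣d+1) = ⊥-elim (p-odd 2∣p)
    where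
    4∣p-2 : + 4 ∣ₛ (t * t - + 1) - (v * v - + 1) * d - (d + + 1)
    4∣p-2 = ∣m∣n⇒∣m-n (∣m∣n⇒∣m-n (∣-trans 4∣8 8∣t²-1) (∣m⇒∣m*n d 4∣v²-1)) 4∣d+1
    2∣p : + 2 ∣ₛ p
    2∣p = ∣-≡ (∣m∣n⇒∣m+n (∣-trans 2∣4 4∣p-2) (∣-refl {+ 2})) (solve (t ∷ v ∷ d ∷ []))

odd-disc⇒even-v : ∀ {p s v D} → + 2 ∣ₛ s → Odd D → + 4 * p ≡ s * s - v * v * D → ¬ Odd v
odd-disc⇒even-v {p} {s} {v} {D} 2∣s D-odd 4p≡ v-odd = odd*odd (odd*odd v-odd v-odd) D-odd 2∣v²D
  where
  open ≡-Reasoning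
  v²D≡ : s * s - + 4 * p ≡ v * v * D
  v²D≡ = begin
    s * s - + 4 * p               ≡⟨ cong (_-_ (s * s)) 4p≡ ⟩
    s * s - (s * s - v * v * D)   ≡⟨ solve (s ∷ v ∷ D ∷ []) ⟩
    v * v * D                     ∎
  2∣v²D : + 2 ∣ₛ v * v * D
  2∣v²D = ∣-≡ (∣m∣n⇒∣m-n (∣m⇒∣m*n s 2∣s) (∣-trans 2∣4 (∣m⇒∣m*n p (∣-refl {+ 4})))) v²D≡

-- d + 1 = (b² − 1) − (b² − d − 2n) − 2 (n − 1), where b is odd because d is.
4∣b²-d-2n⇒4∣d+1 : ∀ {b d n} → Odd d → Odd n → + 4 ∣ₛ b * b - d - + 2 * n → + 4 ∣ₛ d + + 1
4∣b²-d-2n⇒4∣d+1 {b} {d} {n} d-odd n-odd 4∣b²-d-2n =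
  ∣-≡ (∣m∣n⇒∣m-n (∣m∣n⇒∣m-n (∣-trans 4∣8 (8∣odd²-1 b-odd)) 4∣b²-d-2n) 4∣2[n-1])
      (solve (b ∷ d ∷ n ∷ []))
  where
  4∣2[n-1] : + 4 ∣ₛ + 2 * (n - + 1)
  4∣2[n-1] = *-pres-∣ (∣-refl {+ 2}) (odd⇒2∣x-1 n-odd)
  b-odd : Odd b
  b-odd 2∣b = d-odd (∣-≡ (∣m∣n⇒∣m-n (∣m∣n⇒∣m-n (∣m⇒∣m*n b 2∣b) (∣-trans 2∣4 4∣b²-d-2n)) (2∣2* n))
                         (solve (b ∷ d ∷ n ∷ [])))

16∣B²-4d-8n⇒4∣d+1 : ∀ {B d n} → Odd d → Odd n → + 2 ∣ₛ B →
                    + 16 ∣ₛ B * B - (d * + 4 + + 4 * (n * + 2)) → + 4 ∣ₛ d + + 1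
16∣B²-4d-8n⇒4∣d+1 {B} {d} {n} d-odd n-odd (dividesₛ b B≡b*2) 16∣ =
  4∣b²-d-2n⇒4∣d+1 {b} d-odd n-odd
    (*-cancelˡ-∣ (+ 4) {+ 4} {b * b - d - + 2 * n} (∣-≡ 16∣ B²-4d-8n≡))
  where
  open ≡-Reasoning
  B²-4d-8n≡ : B * B - (d * + 4 + + 4 * (n * + 2)) ≡ + 4 * (b * b - d - + 2 * n)
  B²-4d-8n≡ = begin
    B * B - (d * + 4 + + 4 * (n * + 2))
      ≡⟨ cong (λ x → x * x - (d * + 4 + + 4 * (n * + 2))) B≡b*2 ⟩
    b * + 2 * (b * + 2) - (d * + 4 + + 4 * (n * + 2))
      ≡⟨ solve (b ∷ d ∷ n ∷ []) ⟩
    + 4 * (b * b - d - + 2 * n) ∎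

D/4≡0∨3-mod-4 : ℤ → Set
D/4≡0∨3-mod-4 D = Σ ℤ λ d → D ≡ d * + 4 × (+ 4 ∣ₛ d ⊎ + 4 ∣ₛ d + + 1)

16∣⇒D/4≡0-mod-4 : ∀ {D} → + 16 ∣ₛ D → D/4≡0∨3-mod-4 D
16∣⇒D/4≡0-mod-4 (dividesₛ k D≡k*16) =
  k * + 4 , trans D≡k*16 (solve (k ∷ [])) , inj₁ (∣n⇒∣m*n k ∣-refl)

2‖N,4‖D⇒D/4≡3-mod-4 : ∀ {B D N} → 2 ‖ N → 4 ‖ D → + 16 ∣ₛ B * B - (D + + 4 * N) →
                      D/4≡0∨3-mod-4 D
2‖N,4‖D⇒D/4≡3-mod-4 {B} {D} {N} (2∣N , 4∤N) (4∣D , 8∤D) 16∣ = go (∣ᵤ⇒∣ 2∣N) (∣ᵤ⇒∣ 4∣D)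
  where
  go : + 2 ∣ₛ N → + 4 ∣ₛ D → D/4≡0∨3-mod-4 D
  go (dividesₛ n N≡n*2) (dividesₛ d D≡d*4) =
    d , D≡d*4 , inj₂ (16∣B²-4d-8n⇒4∣d+1 d-odd n-odd 2∣B 16∣B²-4d-8n)
    where
    n-odd : Odd n
    n-odd 2∣n = 4∤N (∣⇒∣ᵤ (∣-≡ (*-pres-∣ 2∣n (∣-refl {+ 2})) (sym N≡n*2)))
    d-odd : Odd d
    d-odd 2∣d = 8∤D (∣⇒∣ᵤ (∣-≡ (*-pres-∣ 2∣d (∣-refl {+ 4})) (sym D≡d*4)))
    16∣B²-4d-8n : + 16 ∣ₛ B * B - (d * + 4 + + 4 * (n * + 2))
    16∣B²-4d-8n = ∣-≡ 16∣ (cong₂ (λ D N → B * B - (D + + 4 * N)) D≡d*4 N≡n*2)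
    2∣B : + 2 ∣ₛ B
    2∣B = 2∣x²-e⇒2∣x {B} (∣-trans (dividesₛ (+ 8) refl) 16∣B²-4d-8n)
            (∣m∣n⇒∣m+n (∣n⇒∣m*n d 2∣4) (∣m⇒∣m*n (n * + 2) 2∣4))

[s²-v²D]/4≡1-mod-4 : ∀ {p s v D} → Odd v → Odd p → + 2 ∣ₛ s → + 4 * p ≡ s * s - v * v * D →
                       D/4≡0∨3-mod-4 D → + 4 ∣ₛ p - + 1
[s²-v²D]/4≡1-mod-4 {p} {s} {v} {D} v-odd p-odd (dividesₛ t s≡t*2) 4p≡ (d , D≡d*4 , d-mod-4) =
  t²-v²d≡1-mod-4 {p} {t} {v} {d} v-odd p-odd p≡ d-mod-4
  where
  open ≡-Reasoning
  p≡ : p ≡ t * t - v * v * d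
  p≡ = *-cancelˡ-≡ (+ 4) p (t * t - v * v * d) (begin
    + 4 * p                        ≡⟨ 4p≡ ⟩
    s * s - v * v * D              ≡⟨ cong₂ (λ s D → s * s - v * v * D) s≡t*2 D≡d*4 ⟩
    t * + 2 * (t * + 2) - v * v * (d * + 4) ≡⟨ solve (t ∷ v ∷ d ∷ []) ⟩
    + 4 * (t * t - v * v * d)      ∎)

four-norm : ∀ P u v A B C D → P ≡ u * u - u * v * B + v * v * A * C → B * B - + 4 * A * C ≡ D →
            + 4 * P ≡ (u + (u - v * B)) * (u + (u - v * B)) - v * v * D
four-norm P u v A B C D norm disc = begin
  + 4 * P
    ≡⟨ cong (+ 4 *_) norm ⟩
  + 4 * (u * u - u * v * B + v * v * A * C)
    ≡⟨ solve (u ∷ v ∷ A ∷ B ∷ C ∷ []) ⟩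
  (u + (u - v * B)) * (u + (u - v * B)) - v * v * (B * B - + 4 * A * C)
    ≡⟨ cong (λ D → (u + (u - v * B)) * (u + (u - v * B)) - v * v * D) disc ⟩
  (u + (u - v * B)) * (u + (u - v * B)) - v * v * D ∎
  where open ≡-Reasoning

v-odd⇒p≡1-mod-4 : ∀ A B C D N u v p →
                  p ≡ u * u - u * v * B + v * v * A * C → B * B - + 4 * A * C ≡ D →
                  Odd u → Odd (u - v * B) → Odd p → + (16 ℕ.* N) ∣ₛ B * B - (D + + 4 * + N) →
                  (+ 8 ∣ (D - + 1)) ⊎ (+ 16 ∣ D) ⊎ ((2 ‖ + N) × (4 ‖ D)) → Odd v → + 4 ∣ₛ p - + 1
v-odd⇒p≡1-mod-4 A B C D N u v p norm disc u-odd u'-odd p-odd 16N∣ cond v-odd = go cond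
  where
  2∣s : + 2 ∣ₛ u + (u - v * B)
  2∣s = odd+odd u-odd u'-odd
  4p≡ : + 4 * p ≡ (u + (u - v * B)) * (u + (u - v * B)) - v * v * D
  4p≡ = four-norm p u v A B C D norm disc
  go : (+ 8 ∣ (D - + 1)) ⊎ (+ 16 ∣ D) ⊎ ((2 ‖ + N) × (4 ‖ D)) → + 4 ∣ₛ p - + 1
  go (inj₁ 8∣D-1) =
    ⊥-elim (odd-disc⇒even-v 2∣s (2∣x-1⇒odd (∣-trans (∣-trans 2∣4 4∣8) (∣ᵤ⇒∣ 8∣D-1))) 4p≡ v-odd)
  go (inj₂ (inj₁ 16∣D)) = [s²-v²D]/4≡1-mod-4 v-odd p-odd 2∣s 4p≡ (16∣⇒D/4≡0-mod-4 (∣ᵤ⇒∣ 16∣D))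
  go (inj₂ (inj₂ (2‖N , 4‖D))) =
    [s²-v²D]/4≡1-mod-4 v-odd p-odd 2∣s 4p≡
      (2‖N,4‖D⇒D/4≡3-mod-4 {B} 2‖N 4‖D (∣-trans (∣ᵤ⇒∣ (ℕ.m∣m*n N)) 16N∣))

norm/p≡1 : ∀ p u v A B C w m N .{{_ : NonZero p}} →
           p ≡ u * u - u * v * B + v * v * A * C → u ≡ w * p → C ≡ m * p * N →
           + 1 ≡ w * (u - v * B) + v * v * A * m * N
norm/p≡1 p u v A B C w m N norm u≡wp C≡mpN =
  *-cancelˡ-≡ p (+ 1) (w * (u - v * B) + v * v * A * m * N) (begin
    p * + 1                                        ≡⟨ *-identityʳ p ⟩
    p                                              ≡⟨ norm ⟩
    u * u - u * v * B + v * v * A * C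
      ≡⟨ cong₂ (λ u C → u * u - u * v * B + v * v * A * C) u≡wp C≡mpN ⟩
    w * p * (w * p) - w * p * v * B + v * v * A * (m * p * N)
      ≡⟨ solve (p ∷ v ∷ A ∷ B ∷ w ∷ m ∷ N ∷ []) ⟩
    p * (w * (w * p - v * B) + v * v * A * m * N)
      ≡⟨ cong (λ u → p * (w * (u - v * B) + v * v * A * m * N)) (sym u≡wp) ⟩
    p * (w * (u - v * B) + v * v * A * m * N) ∎)
  where open ≡-Reasoning

xy+even≡1⇒odd : ∀ {x y z} → + 1 ≡ x * y + z → + 2 ∣ₛ z → Odd x × Odd y
xy+even≡1⇒odd {x} {y} 1≡xy+z 2∣z =
  (λ 2∣x → 2∤1 (∣-≡ (∣m∣n⇒∣m+n (∣m⇒∣m*n y 2∣x) 2∣z) (sym 1≡xy+z))) ,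
  (λ 2∣y → 2∤1 (∣-≡ (∣m∣n⇒∣m+n (∣n⇒∣m*n x 2∣y) 2∣z) (sym 1≡xy+z)))

norm-parity : ∀ p u v A B C m N .{{_ : NonZero p}} → p ≡ u * u - u * v * B + v * v * A * C →
              p ∣ₛ u → C ≡ m * p * N → + 2 ∣ₛ N → Odd p → Odd u × Odd (u - v * B)
norm-parity p u v A B C m N norm (dividesₛ w u≡wp) C≡mpN 2∣N p-odd =
  subst Odd (sym u≡wp) (odd*odd (proj₁ w,u'-odd) p-odd) , proj₂ w,u'-odd
  where
  w,u'-odd : Odd w × Odd (u - v * B)
  w,u'-odd = xy+even≡1⇒odd (norm/p≡1 p u v A B C w m N norm u≡wp C≡mpN)
                            (∣n⇒∣m*n (v * v * A * m) 2∣N)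

Ac≡1-mod-4 : ∀ A B C D c N .{{_ : ℕ.NonZero N}} → B * B - + 4 * A * C ≡ D → C ≡ c * + N →
             + (16 ℕ.* N) ∣ₛ B * B - (D + + 4 * + N) → + 4 ∣ₛ A * c - + 1
Ac≡1-mod-4 A B C D c N disc C≡cN 16N∣ =
  *-cancelˡ-∣ (+ 4) {+ 4} {A * c - + 1} (*-cancelˡ-∣ (+ N) {+ 4 * + 4} {+ 4 * (A * c - + 1)} N*16∣)
  where
  open ≡-Reasoning
  eq : B * B - (D + + 4 * + N) ≡ + N * (+ 4 * (A * c - + 1))
  eq = begin
    B * B - (D + + 4 * + N)
      ≡⟨ cong (λ D → B * B - (D + + 4 * + N)) (sym disc) ⟩
    B * B - (B * B - + 4 * A * C + + 4 * + N)
      ≡⟨ cong (λ C → B * B - (B * B - + 4 * A * C + + 4 * + N)) C≡cN ⟩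
    B * B - (B * B - + 4 * A * (c * + N) + + 4 * + N)
      ≡⟨ rearrange (+ N) ⟩
    + N * (+ 4 * (A * c - + 1)) ∎
    where
    rearrange : ∀ n → B * B - (B * B - + 4 * A * (c * n) + + 4 * n) ≡ n * (+ 4 * (A * c - + 1))
    rearrange n = solve (A ∷ B ∷ c ∷ n ∷ [])
  N*16∣ : + N * + 16 ∣ₛ + N * (+ 4 * (A * c - + 1))
  N*16∣ = ∣-trans (∣-reflexive (trans (*-comm (+ N) (+ 16)) (sym (pos-* 16 N)))) (∣-≡ 16N∣ eq)

m≡Ap-mod-4 : ∀ A m p → Odd p → + 4 ∣ₛ A * (m * p) - + 1 → + 4 ∣ₛ m - A * p
m≡Ap-mod-4 A m p p-odd 4∣Amp-1 =
  am≡1⇒m≡a-mod-4 {A * p} {m} (odd*odd A-odd p-odd) (∣-≡ 4∣Amp-1 (solve (A ∷ m ∷ p ∷ [])))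
  where
  A-odd : Odd A
  A-odd 2∣A = 2∣x-1⇒odd (∣-trans 2∣4 4∣Amp-1) (∣m⇒∣m*n (m * p) 2∣A)

prime∤even⇒odd : ∀ {p n} → Prime p → 2 ℕ.∣ n → ¬ p ℕ.∣ n → Odd (+ p)
prime∤even⇒odd p-prime 2∣n p∤n 2∣p with prime⇒irreducible p-prime (∣⇒∣ᵤ 2∣p)
... | inj₁ ()
... | inj₂ refl = p∤n 2∣n

C≡m*p*N : ∀ p C N → Prime p → + p ∣ C → + N ∣ₛ C → ¬ p ℕ.∣ N → Σ ℤ λ m → C ≡ m * + p * + N
C≡m*p*N p C N p-prime p∣C (dividesₛ k C≡kN) p∤N
  with euclidsLemma ∣ k ∣ N p-prime (subst (p ℕ.∣_) (trans (cong ∣_∣ C≡kN) (abs-* k (+ N))) p∣C)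
... | inj₁ p∣k = quotient p∣ₛk , trans C≡kN (cong (_* + N) (equality p∣ₛk))
  where
  p∣ₛk : + p ∣ₛ k
  p∣ₛk = ∣ᵤ⇒∣ p∣k
... | inj₂ p∣N = ⊥-elim (p∤N p∣N)

*-//-cancel : ∀ k d .{{_ : ℕ.NonZero d}} → (k * + d) // d ≡ k
*-//-cancel (+ n) (suc d) =
  trans (cong (_/ℕ suc d) (sym (pos-* n (suc d)))) (cong +_ (ℕ.m*n/n≡m n (suc d)))
*-//-cancel -[1+ n ] (suc d) with ℕ.suc (d ℕ.+ n ℕ.* suc d) ℕ.% suc d | ℕ.m*n%n≡0 (suc n) (suc d)
... | 0 | _ = cong (λ z → - (+ z)) (ℕ.m*n/n≡m (suc n) (suc d))

8∣x⇒4∣kx/2 : ∀ k {x} → + 8 ∣ₛ x → + 4 ∣ₛ (k * x) // 2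
8∣x⇒4∣kx/2 k {x} (dividesₛ e x≡e*8) = ∣-≡ (∣n⇒∣m*n (k * e) (∣-refl {+ 4})) (sym kx/2≡)
  where
  open ≡-Reasoning
  kx/2≡ : (k * x) // 2 ≡ k * e * + 4
  kx/2≡ = begin
    (k * x) // 2               ≡⟨ cong (λ x → (k * x) // 2) x≡e*8 ⟩
    (k * (e * + 8)) // 2       ≡⟨ cong (_// 2) (k * (e * + 8) ≡ k * e * + 4 * + 2
                                                  ∋ solve (k ∷ e ∷ [])) ⟩
    (k * e * + 4 * + 2) // 2   ≡⟨ *-//-cancel (k * e * + 4) 2 ⟩
    k * e * + 4                ∎

-- The first summand is (N − 1) v u' (m − A) − (N − 1) v A w (u'² − 1).
4∣θ-shape : ∀ N N₁ A u' v v₁ A₁ m w Z → Odd u' → Odd N₁ → + 4 ∣ₛ v * (m - A) → + 4 ∣ₛ Z →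
            + 4 ∣ₛ (N - + 1) * v * (u' * m + A * (w * (+ 1 - u' * u') - u'))
                   + + 3 * v₁ * A₁ * (N₁ - + 1) * (u' - + 1) + Z
4∣θ-shape N N₁ A u' v v₁ A₁ m w Z u'-odd N₁-odd 4∣v[m-A] 4∣Z =
  ∣-≡ (∣m∣n⇒∣m+n (∣m∣n⇒∣m+n (∣m∣n⇒∣m-n
        (∣n⇒∣m*n ((N - + 1) * u') 4∣v[m-A])
        (∣n⇒∣m*n ((N - + 1) * v * A * w) (∣-trans 4∣8 (8∣odd²-1 u'-odd))))
        (∣n⇒∣m*n (+ 3 * v₁ * A₁) (*-pres-∣ (odd⇒2∣x-1 N₁-odd) (odd⇒2∣x-1 u'-odd))))
        4∣Z)
      (solve (N ∷ N₁ ∷ A ∷ u' ∷ v ∷ v₁ ∷ A₁ ∷ m ∷ w ∷ Z ∷ []))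

4∣theta : ∀ N N₁ lam p A B C u v v₁ A₁ m .{{_ : ℕ.NonZero N}} .{{_ : ℕ.NonZero p}} →
          C ≡ m * + p * + N → Odd (u - v * B) → Odd (+ N₁) → + 4 ∣ₛ v * (m - A) →
          + 4 ∣ₛ theta N N₁ lam p A B C u v v₁ A₁
4∣theta N N₁ lam p A B C u v v₁ A₁ m C≡mpN u'-odd N₁-odd 4∣v[m-A] =
  4∣θ-shape (+ N) (+ N₁) A u' v v₁ A₁
    (C // (N ℕ.* p)) (u // p) ((+ 3 * + lam * (u' * u' - + 1)) // 2)
    u'-odd N₁-odd (subst (λ m → + 4 ∣ₛ v * (m - A)) (sym C/Np≡m) 4∣v[m-A])
    (8∣x⇒4∣kx/2 (+ 3 * + lam) (8∣odd²-1 u'-odd))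
  where
  u' = u - v * B
  C/Np≡m : C // (N ℕ.* p) ≡ m
  C/Np≡m = trans (cong (_// (N ℕ.* p)) (trans C≡mpN mpN≡)) (*-//-cancel m (N ℕ.* p) {{ℕ.m*n≢0 N p}})
    where
    mpN≡ : m * + p * + N ≡ m * + (N ℕ.* p)
    mpN≡ = trans (*-assoc m (+ p) (+ N))
                 (cong (m *_) (trans (*-comm (+ p) (+ N)) (sym (pos-* N p))))

mainTheorem9 :
    (N lam N₁ : ℕ) → 1 ℕ.< N → N ≡ 2 ℕ.^ lam ℕ.* N₁ → OddZ (+ N₁) →
    (D Δ : ℤ) (c : ℕ) → 1 ℕ.≤ c → FundamentalDisc Δ → D ≡ + (c ℕ.* c) * Δ → D < + 0 →
    (A B C : ℤ) → B * B - + 4 * A * C ≡ D → gcd (gcd A B) C ≡ + 1 → A > + 0 →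
    gcd A (+ N) ≡ + 1 → + N ∣ C →
    (u v : ℤ) (p : ℕ) → Prime p → + p ≡ u * u - u * v * B + v * v * A * C →
    ¬ (+ p ∣ + (6 ℕ.* c ℕ.* N)) → SplitsIn p D → + p ∣ C → + p ∣ u →
    (v₁ A₁ : ℤ) → OddPart v v₁ → OddPart A A₁ →
    -- N even, B^2 ≡ D + 4N (mod 16N)
    + 2 ∣ + N → + (16 ℕ.* N) ∣ (B * B - (D + + 4 * + N)) →
    ((+ 8 ∣ (D - + 1)) ⊎ (+ 16 ∣ D) ⊎ ((2 ‖ + N) × (4 ‖ D))) →
    + 4 ∣ theta N N₁ lam p A B C u v v₁ A₁
mainTheorem9 N lam N₁ 1<N _ N₁-odd D _ c _ _ _ _ A B C disc _ _ _ N∣C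
             u v p p-prime norm p∤6cN _ p∣C p∣u v₁ A₁ _ _ 2∣N 16N∣ cond =
  ∣⇒∣ᵤ (4∣theta N N₁ lam p A B C u v v₁ A₁ m C≡mpN (proj₂ u,u'-odd) (N₁-odd ∘ ∣⇒∣ᵤ) 4∣v[m-A])
  where
  instance
    N≢0 : ℕ.NonZero N
    N≢0 = ℕ.>-nonZero (ℕ.<-trans (ℕ.s≤s ℕ.z≤n) 1<N)
    p≢0 : ℕ.NonZero p
    p≢0 = prime⇒nonZero p-prime
  p-odd : Odd (+ p)
  p-odd = prime∤even⇒odd p-prime
            (ℕ.∣-trans (ℕ.∣-trans (ℕ.divides 3 refl) (ℕ.m∣m*n c)) (ℕ.m∣m*n N)) p∤6cN
  cofactor : Σ ℤ λ m → C ≡ m * + p * + N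
  cofactor = C≡m*p*N p C N p-prime p∣C (∣ᵤ⇒∣ N∣C)
               (λ p∣N → p∤6cN (ℕ.∣-trans p∣N (ℕ.n∣m*n (6 ℕ.* c))))
  m = proj₁ cofactor
  C≡mpN = proj₂ cofactor
  u,u'-odd : Odd u × Odd (u - v * B)
  u,u'-odd = norm-parity (+ p) u v A B C m (+ N) norm (∣ᵤ⇒∣ p∣u) C≡mpN (∣ᵤ⇒∣ 2∣N) p-odd
  4∣v[m-A] : + 4 ∣ₛ v * (m - A)
  4∣v[m-A] = 4∣v[m-a] v m A (+ p)
    (m≡Ap-mod-4 A m (+ p) p-odd (Ac≡1-mod-4 A B C D (m * + p) N disc C≡mpN (∣ᵤ⇒∣ 16N∣)))
    p-odd
    (v-odd⇒p≡1-mod-4 A B C D N u v (+ p) norm disc (proj₁ u,u'-odd) (proj₂ u,u'-odd) p-odd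
       (∣ᵤ⇒∣ 16N∣) cond)
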